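{- Let $k$ be a positive integer and $\mathcal C$ a $c$-good $k$-configuration which implies the star $\{x_1+x_2=x_3+x_4=\cdots=x_{2p-1}+x_{2p}\}$ (with $2p\le k$). Then every difference equality in the variables $x_1,\dots,x_{2p}$ implied by $\mathcal C$ is implied by this star.
   Context: Standing parameters: $\varepsilon,k_0,c$ satisfy $0<\varepsilon\le 1/4096$, $k_0\ge 32/\varepsilon^2$ and $2-\min\{\varepsilon^2/32,\,2/k_0\}\le c\le 2$. All linear equations are over $\mathbb Q$ in variables $x_1,\dots,x_k$, considered up to rearrangement but not scaling; the content of an equation is an expression $*$ with the equation reading $*=0$. Equations are independent if their contents are linearly independent; a collection implies an equation if its content is a $\mathbb Q$-linear combination of the contents of the collection. An equation contains a variable if its coefficient is nonzero. A difference equality is a nontrivial equation $x_{i_1}-x_{i_2}=x_{i_3}-x_{i_4}$ ($i_1,\dots,i_4\in[k]$ not necessarily distinct). A $k$-configuration is a system of difference equalities in $x_1,\dots,x_k$. A collection is valid if it does not imply $x_a=x_b$ for $a\ne b$; collinearity-free if it implies no equation containing exactly three variables; $c$-light if for every $t\ge1$ any $t$ independent equations it implies together contain at least $ct+1$ variables; $c$-good if valid, collinearity-free and $c$-light.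
   Formalization: The standing parameters ε and c are rational, and k₀ is allowed to be any positive rational. -}

module Defs where

open import Data.Nat as ℕ using (ℕ; zero; suc; _≟_)
open import Data.Fin as Fin using (Fin; toℕ)
open import Data.Fin.Properties using (any?)
open import Data.Integer using (+_)
open import Data.Rational using (ℚ; 0ℚ; 1ℚ; _+_; _-_; _*_; _/_)
open import Data.Rational.Properties as ℚP using ()
open import Data.List using (List; []; _∷_; length; lookup; filter; map; upTo; allFin)
open import Data.List.Relation.Unary.All using (All)
open import Data.Product using (Σ; ∃; _×_; _,_)
open import Relation.Nullary using (¬_; ¬?)
open import Relation.Nullary.Decidable using (⌊_⌋)
open import Relation.Binary.PropositionalEquality using (_≡_; _≢_)

-- The content of a linear equation in x₁,…,x_k (variable x_{j+1} ↔ index j : Fin k):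
-- the coefficient vector of the expression * in "* = 0".
Form : ℕ → Set
Form k = Fin k → ℚ

ℕ→ℚ : ℕ → ℚ
ℕ→ℚ n = + n / 1

sumᶠ : ∀ {t} → (Fin t → ℚ) → ℚ
sumᶠ {zero}  f = 0ℚ
sumᶠ {suc t} f = f Fin.zero + sumᶠ (λ i → f (Fin.suc i))

var : ∀ {k} → ℕ → Form k
var n j with toℕ j ≟ n
... | Relation.Nullary.yes _ = 1ℚ
... | Relation.Nullary.no _  = 0ℚ

_⊕_ _⊖_ : ∀ {k} → Form k → Form k → Form k
(f ⊕ g) j = f j + g j
(f ⊖ g) j = f j - g j
infixl 6 _⊕_ _⊖_

_≈_ : ∀ {k} → Form k → Form k → Set
f ≈ g = ∀ j → f j ≡ g j

-- content x_{i₁} - x_{i₂} - x_{i₃} + x_{i₄}  of  x_{i₁} - x_{i₂} = x_{i₃} - x_{i₄}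
diffForm : ∀ {k} → Fin k → Fin k → Fin k → Fin k → Form k
diffForm i₁ i₂ i₃ i₄ = var (toℕ i₁) ⊖ var (toℕ i₂) ⊖ var (toℕ i₃) ⊕ var (toℕ i₄)

IsZero : ∀ {k} → Form k → Set
IsZero f = ∀ j → f j ≡ 0ℚ

IsDiffEq : ∀ {k} → Form k → Set
IsDiffEq {k} f =
  Σ (Fin k) λ i₁ → Σ (Fin k) λ i₂ → Σ (Fin k) λ i₃ → Σ (Fin k) λ i₄ →
    (f ≈ diffForm i₁ i₂ i₃ i₄) × ¬ IsZero f

record Config (k : ℕ) : Set where
  field
    eqs    : List (Form k)
    allDiff : All IsDiffEq eqs
open Config public

Implies : ∀ {k} → List (Form k) → Form k → Set
Implies {k} L f =
  Σ (Fin (length L) → ℚ) λ a → ∀ j → f j ≡ sumᶠ (λ i → a i * lookup L i j)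

Independent : ∀ {k t} → (Fin t → Form k) → Set
Independent {k} {t} F =
  ∀ (a : Fin t → ℚ) → (∀ j → sumᶠ (λ i → a i * F i j) ≡ 0ℚ) → ∀ i → a i ≡ 0ℚ

numVars : ∀ {k t} → (Fin t → Form k) → ℕ
numVars {k} {t} F =
  length (filter (λ j → any? (λ i → ¬? (F i j ℚP.≟ 0ℚ))) (allFin k))


numVars₁ : ∀ {k} → Form k → ℕ
numVars₁ f = numVars {t = 1} (λ _ → f)

Valid : ∀ {k} → List (Form k) → Set
Valid {k} L = ∀ (a b : Fin k) → a ≢ b →
  ¬ Implies L (var (toℕ a) ⊖ var (toℕ b))

CollinearityFree : ∀ {k} → List (Form k) → Set
CollinearityFree L = ∀ f → Implies L f → numVars₁ f ≢ 3

Light : ∀ {k} → ℚ → List (Form k) → Set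
Light {k} c L = ∀ (t : ℕ) → 1 ℕ.≤ t → (F : Fin t → Form k) →
  Independent F → (∀ i → Implies L (F i)) →
  c * ℕ→ℚ t + 1ℚ Data.Rational.≤ ℕ→ℚ (numVars F)

Good : ∀ {k} → ℚ → List (Form k) → Set
Good c L = Valid L × CollinearityFree L × Light c L

-- the star x₁+x₂ = x₃+x₄ = ⋯ = x_{2p-1}+x_{2p}, as the p-1 equations
-- (x_{2i+1}+x_{2i+2}) - (x_{2i+3}+x_{2i+4}) = 0 for i = 0,…,p-2
star : ∀ {k} → ℕ → List (Form k)
star p = map (λ i → var (2 ℕ.* i) ⊕ var (suc (2 ℕ.* i))
                    ⊖ var (2 ℕ.+ 2 ℕ.* i) ⊖ var (3 ℕ.+ 2 ℕ.* i))
             (upTo (p ℕ.∸ 1))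

InVars : ∀ {k} → ℕ → Form k → Set
InVars m f = ∀ j → m ℕ.≤ toℕ j → f j ≡ 0ℚ

module Submission where

-- Call x_{2m+1}, x_{2m+2} the m-th pair and put P_m = x_{2m+1} + x_{2m+2}, so that the star implies
-- every P_a − P_b with a, b < p. Only c-lightness with c > 9/5 is used: it rules out t ≤ 5 independent
-- implied equations involving at most t pairs, since these contain at most 2t < ct + 1 variables.
-- Let f be an implied difference equality in x_1, …, x_{2p}. If f gave the two variables of a pair m
-- different coefficients, then f together with the P_m − P_j, j ranging over the other pairs met by f,
-- would be such a family; it is independent because each P_m − P_j treats the two variables of a pair
-- alike. Hence f = Σ r_m P_m, so f − (Σ r_m) P_0 = Σ r_m (P_m − P_0) is implied by the star, and then
-- (Σ r_m) P_0 is an implied equation in two variables, which lightness forces to be trivial.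

module PairSymmetry where

  open import Defs
  open import Algebra.Bundles using (CommutativeRing)
  open import Data.Empty using (⊥)
  open import Data.Fin using (Fin; zero; suc; toℕ; fromℕ<; punchIn)
  open import Data.Fin.Properties as FinP using (toℕ-fromℕ<; toℕ-injective; punchInᵢ≢i; pigeonhole; any?)
  open import Data.Integer as ℤ using (+_)
  import Data.Integer.Properties as ℤP
  open import Data.List using (List; []; _∷_; length; lookup; filter; map; allFin; deduplicate)
  open import Data.List.Membership.Propositional using (_∈_)
  open import Data.List.Membership.Propositional.Properties
    using (∈-lookup; ∈-map⁺; ∈-map⁻; ∈-filter⁺; ∈-filter⁻; ∈-upTo⁺; ∈-deduplicate⁺; ∈-deduplicate⁻)
  open import Data.List.Properties using (length-map; length-filter; length-deduplicate)
  open import Data.List.Relation.Binary.Subset.Propositional using (_⊆_)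
  open import Data.List.Relation.Unary.All as All using (All; []; _∷_)
  open import Data.List.Relation.Unary.All.Properties using (all-filter)
  open import Data.List.Relation.Unary.AllPairs using (_∷_)
  open import Data.List.Relation.Unary.Any as Any using (here; there)
  open import Data.List.Relation.Unary.Any.Properties using (lookup-index)
  open import Data.List.Relation.Unary.Unique.Propositional using (Unique)
  import Data.List.Relation.Unary.Unique.Propositional.Properties as Unique
  open import Data.Nat as ℕ using (ℕ; zero; suc; _≤_; _<_; _*_; _<?_; ⌊_/2⌋; z≤n; s≤s)
  import Data.Nat.Coprimality as Coprimality
  open import Data.List.Relation.Unary.Unique.DecPropositional.Properties ℕ._≟_ using (deduplicate-!)
  import Data.Nat.Properties as ℕP
  open import Data.Product using (Σ; ∃-syntax; _,_; proj₁; proj₂)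
  open import Data.Rational as ℚ using (ℚ; 0ℚ; 1ℚ; mkℚ; _+_; _-_; -_; _/_; _⊓_; *≤*)
    renaming (_*_ to _*ℚ_; _≤_ to _≤ℚ_; _<_ to _<ℚ_)
  import Data.Rational.Properties as ℚP
  open import Data.Rational.Solver using (module +-*-Solver)
  open import Data.Sum using (_⊎_; inj₁; inj₂; [_,_])
  open import Data.Vec.Functional using () renaming (_∷_ to _◂_)
  open import Function using (_∘_)
  open import Relation.Binary.PropositionalEquality
    using (_≡_; _≢_; refl; sym; trans; cong; cong₂; subst; subst₂; module ≡-Reasoning)
  open import Relation.Nullary using (Dec; ¬?; yes; no; contradiction)
  open import Relation.Nullary.Decidable using (toWitness; decidable-stable)

  open import Algebra.Apartness.Properties.HeytingCommutativeRing ℚP.heytingCommutativeRing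
    using (x#0y#0→xy#0)
  open import Algebra.Properties.Group ℚP.+-0-group using (x∙y⁻¹≈ε⇒x≈y)
  open import Algebra.Properties.Semiring.Sum (CommutativeRing.semiring ℚP.+-*-commutativeRing)
    using (sum; sum-cong-≗; ∑-distrib-+; *-distribˡ-sum; sum-replicate-zero; sum-remove)
  open +-*-Solver using (solve; _:+_; _:-_; _:*_; _:=_)

  private
    variable
      k t : ℕ

  p*q≡0⇒p≡0 : ∀ {p q} → q ≢ 0ℚ → p *ℚ q ≡ 0ℚ → p ≡ 0ℚ
  p*q≡0⇒p≡0 {p} q≢0 pq≡0 = decidable-stable (p ℚP.≟ 0ℚ) λ p≢0 → x#0y#0→xy#0 p≢0 q≢0 pq≡0

  p≢q⇒p≢0⊎q≢0 : ∀ {p q} → p ≢ q → p ≢ 0ℚ ⊎ q ≢ 0ℚ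
  p≢q⇒p≢0⊎q≢0 {p} {q} p≢q with p ℚP.≟ 0ℚ
  ... | no  p≢0 = inj₁ p≢0
  ... | yes p≡0 = inj₂ λ q≡0 → p≢q (trans p≡0 (sym q≡0))

  ℕ→ℚ≡mkℚ : ∀ n → ℕ→ℚ n ≡ mkℚ (+ n) 0 (Coprimality.sym (Coprimality.1-coprimeTo n))
  ℕ→ℚ≡mkℚ n = ℚP.normalize-coprime (Coprimality.sym (Coprimality.1-coprimeTo n))

  ℕ→ℚ-mono-≤ : ∀ {m n} → m ≤ n → ℕ→ℚ m ≤ℚ ℕ→ℚ n
  ℕ→ℚ-mono-≤ {m} {n} m≤n rewrite ℕ→ℚ≡mkℚ m | ℕ→ℚ≡mkℚ n =
    *≤* (subst₂ ℤ._≤_ (sym (ℤP.*-identityʳ (+ m))) (sym (ℤP.*-identityʳ (+ n))) (ℤ.+≤+ m≤n))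

  sumᶠ≡sum : (f : Fin t → ℚ) → sumᶠ f ≡ sum f
  sumᶠ≡sum {zero}  f = refl
  sumᶠ≡sum {suc t} f = cong (_+_ (f zero)) (sumᶠ≡sum (f ∘ suc))

  sumᶠ-cong : {f g : Fin t → ℚ} → (∀ i → f i ≡ g i) → sumᶠ f ≡ sumᶠ g
  sumᶠ-cong {f = f} {g} f≗g = begin
    sumᶠ f ≡⟨ sumᶠ≡sum f ⟩
    sum f  ≡⟨ sum-cong-≗ f≗g ⟩
    sum g  ≡⟨ sumᶠ≡sum g ⟨
    sumᶠ g ∎
    where open ≡-Reasoning

  sumᶠ-zero : {f : Fin t → ℚ} → (∀ i → f i ≡ 0ℚ) → sumᶠ f ≡ 0ℚ
  sumᶠ-zero {t} f≡0 = trans (sumᶠ-cong f≡0) (trans (sumᶠ≡sum {t} (λ _ → 0ℚ)) (sum-replicate-zero t))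

  sumᶠ-+ : (f g : Fin t → ℚ) → sumᶠ (λ i → f i + g i) ≡ sumᶠ f + sumᶠ g
  sumᶠ-+ f g = begin
    sumᶠ (λ i → f i + g i) ≡⟨ sumᶠ≡sum (λ i → f i + g i) ⟩
    sum (λ i → f i + g i)  ≡⟨ ∑-distrib-+ f g ⟩
    sum f + sum g          ≡⟨ cong₂ _+_ (sumᶠ≡sum f) (sumᶠ≡sum g) ⟨
    sumᶠ f + sumᶠ g        ∎
    where open ≡-Reasoning

  sumᶠ-*ˡ : (r : ℚ) (f : Fin t → ℚ) → sumᶠ (λ i → r *ℚ f i) ≡ r *ℚ sumᶠ f
  sumᶠ-*ˡ r f = begin
    sumᶠ (λ i → r *ℚ f i) ≡⟨ sumᶠ≡sum (λ i → r *ℚ f i) ⟩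
    sum (λ i → r *ℚ f i)  ≡⟨ *-distribˡ-sum r f ⟨
    r *ℚ sum f            ≡⟨ cong (r *ℚ_) (sumᶠ≡sum f) ⟨
    r *ℚ sumᶠ f           ∎
    where open ≡-Reasoning

  sumᶠ-single : (f : Fin t → ℚ) (i : Fin t) → (∀ j → j ≢ i → f j ≡ 0ℚ) → sumᶠ f ≡ f i
  sumᶠ-single {suc t} f i others≡0 = begin
    sumᶠ f                        ≡⟨ sumᶠ≡sum f ⟩
    sum f                         ≡⟨ sum-remove {i = i} f ⟩
    f i + sum (f ∘ punchIn i) ≡⟨ cong (_+_ (f i)) (sum-cong-≗ λ j → others≡0 (punchIn i j) (punchInᵢ≢i i j)) ⟩
    f i + sum {t} (λ _ → 0ℚ)  ≡⟨ cong (_+_ (f i)) (sum-replicate-zero t) ⟩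
    f i + 0ℚ                  ≡⟨ ℚP.+-identityʳ (f i) ⟩
    f i                       ∎
    where open ≡-Reasoning

  _·_ : ℚ → Form k → Form k
  (r · f) j = r *ℚ f j

  infixl 7 _·_

  𝟎 : Form k
  𝟎 _ = 0ℚ

  module LinearCombination {k : ℕ} (L : List (Form k)) where

    implies-resp-≈ : {f g : Form k} → f ≈ g → Implies L f → Implies L g
    implies-resp-≈ f≈g (a , f≡∑) = a , λ j → trans (sym (f≈g j)) (f≡∑ j)

    implies-𝟎 : Implies L 𝟎
    implies-𝟎 = (λ _ → 0ℚ) , λ j → sym (sumᶠ-zero λ i → ℚP.*-zeroˡ (lookup L i j))

    implies-⊕ : {f g : Form k} → Implies L f → Implies L g → Implies L (f ⊕ g)
    implies-⊕ (a , f≡∑) (b , g≡∑) = (λ i → a i + b i) , λ j → begin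
      _ ≡⟨ cong₂ _+_ (f≡∑ j) (g≡∑ j) ⟩
      sumᶠ (λ i → a i *ℚ lookup L i j) + sumᶠ (λ i → b i *ℚ lookup L i j)
        ≡⟨ sumᶠ-+ (λ i → a i *ℚ lookup L i j) (λ i → b i *ℚ lookup L i j) ⟨
      sumᶠ (λ i → a i *ℚ lookup L i j + b i *ℚ lookup L i j)
        ≡⟨ sumᶠ-cong (λ i → ℚP.*-distribʳ-+ (lookup L i j) (a i) (b i)) ⟨
      sumᶠ (λ i → (a i + b i) *ℚ lookup L i j) ∎
      where open ≡-Reasoning

    implies-· : {f : Form k} (r : ℚ) → Implies L f → Implies L (r · f)
    implies-· r (a , f≡∑) = (λ i → r *ℚ a i) , λ j → begin
      _ ≡⟨ cong (_*ℚ_ r) (f≡∑ j) ⟩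
      r *ℚ sumᶠ (λ i → a i *ℚ lookup L i j)
        ≡⟨ sumᶠ-*ˡ r (λ i → a i *ℚ lookup L i j) ⟨
      sumᶠ (λ i → r *ℚ (a i *ℚ lookup L i j))
        ≡⟨ sumᶠ-cong (λ i → ℚP.*-assoc r (a i) (lookup L i j)) ⟨
      sumᶠ (λ i → r *ℚ a i *ℚ lookup L i j) ∎
      where open ≡-Reasoning

    implies-⊖ : {f g : Form k} → Implies L f → Implies L g → Implies L (f ⊖ g)
    implies-⊖ {f} {g} ⊢f ⊢g = implies-resp-≈ f-g≈f⊖g (implies-⊕ ⊢f (implies-· (- 1ℚ) ⊢g))
      where
      f-g≈f⊖g : (f ⊕ (- 1ℚ) · g) ≈ (f ⊖ g)
      f-g≈f⊖g j = cong (_+_ (f j)) (trans (sym (ℚP.neg-distribˡ-* 1ℚ (g j))) (cong -_ (ℚP.*-identityˡ (g j))))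

  implies-here : (f : Form k) (L : List (Form k)) → Implies (f ∷ L) f
  implies-here f L = coefficients , λ j → sym (begin
    1ℚ *ℚ f j + sumᶠ (λ i → 0ℚ *ℚ lookup L i j)
      ≡⟨ cong₂ _+_ (ℚP.*-identityˡ (f j)) (sumᶠ-zero λ i → ℚP.*-zeroˡ (lookup L i j)) ⟩
    f j + 0ℚ
      ≡⟨ ℚP.+-identityʳ (f j) ⟩
    f j ∎)
    where
    open ≡-Reasoning
    coefficients : Fin (suc (length L)) → ℚ
    coefficients zero    = 1ℚ
    coefficients (suc _) = 0ℚ

  implies-there : {f : Form k} (g : Form k) {L : List (Form k)} → Implies L f → Implies (g ∷ L) f
  implies-there {k} {f} g {L} (a , f≡∑) = coefficients , λ j → trans (f≡∑ j) (sym (begin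
    0ℚ *ℚ g j + combination j ≡⟨ cong (λ x → x + combination j) (ℚP.*-zeroˡ (g j)) ⟩
    0ℚ + combination j        ≡⟨ ℚP.+-identityˡ (combination j) ⟩
    combination j             ∎))
    where
    open ≡-Reasoning
    combination : Form k
    combination j = sumᶠ (λ i → a i *ℚ lookup L i j)
    coefficients : Fin (suc (length L)) → ℚ
    coefficients zero    = 0ℚ
    coefficients (suc i) = a i

  implies-∈ : {f : Form k} {L : List (Form k)} → f ∈ L → Implies L f
  implies-∈ {L = f ∷ L} (here refl) = implies-here f L
  implies-∈ {L = g ∷ L} (there f∈L) = implies-there g {L} (implies-∈ f∈L)

  implies-trans : {L M : List (Form k)} {f : Form k} → All (Implies L) M → Implies M f → Implies L f
  implies-trans {L = L} {M = []}    []        (_ , f≡0) = implies-resp-≈ (λ j → sym (f≡0 j)) implies-𝟎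
    where open LinearCombination L
  implies-trans {L = L} {M = m ∷ M} (⊢m ∷ ⊢M) (a , f≡∑) =
    implies-resp-≈ (λ j → sym (f≡∑ j))
      (implies-⊕ (implies-· (a zero) ⊢m) (implies-trans {L = L} {M = M} ⊢M (a ∘ suc , λ _ → refl)))
    where open LinearCombination L

  -- Pairs of variables

  ⌊2*n/2⌋≡n : ∀ n → ⌊ 2 * n /2⌋ ≡ n
  ⌊2*n/2⌋≡n n = trans (cong (λ m → ⌊ n ℕ.+ m /2⌋) (ℕP.+-identityʳ n)) (sym (ℕP.n≡⌊n+n/2⌋ n))

  ⌊1+2*n/2⌋≡n : ∀ n → ⌊ suc (2 * n) /2⌋ ≡ n
  ⌊1+2*n/2⌋≡n zero    = refl
  ⌊1+2*n/2⌋≡n (suc n) = trans (cong (⌊_/2⌋ ∘ suc) (ℕP.*-suc 2 n)) (cong suc (⌊1+2*n/2⌋≡n n))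

  n≡2⌊n/2⌋⊎n≡1+2⌊n/2⌋ : ∀ n → n ≡ 2 * ⌊ n /2⌋ ⊎ n ≡ suc (2 * ⌊ n /2⌋)
  n≡2⌊n/2⌋⊎n≡1+2⌊n/2⌋ zero          = inj₁ refl
  n≡2⌊n/2⌋⊎n≡1+2⌊n/2⌋ (suc zero)    = inj₂ refl
  n≡2⌊n/2⌋⊎n≡1+2⌊n/2⌋ (suc (suc n)) with n≡2⌊n/2⌋⊎n≡1+2⌊n/2⌋ n
  ... | inj₁ n≡even = inj₁ (trans (cong (2 ℕ.+_) n≡even) (sym (ℕP.*-suc 2 ⌊ n /2⌋)))
  ... | inj₂ n≡odd  = inj₂ (trans (cong (2 ℕ.+_) n≡odd) (cong suc (sym (ℕP.*-suc 2 ⌊ n /2⌋))))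

  2*⌊n/2⌋≤n : ∀ n → 2 * ⌊ n /2⌋ ≤ n
  2*⌊n/2⌋≤n n with n≡2⌊n/2⌋⊎n≡1+2⌊n/2⌋ n
  ... | inj₁ n≡even = ℕP.≤-reflexive (sym n≡even)
  ... | inj₂ n≡odd  = ℕP.≤-trans (ℕP.n≤1+n _) (ℕP.≤-reflexive (sym n≡odd))

  pairOf : Fin k → ℕ
  pairOf v = ⌊ toℕ v /2⌋

  -- Variables are indexed from 0: pair m consists of x_{2m+1} and x_{2m+2}.
  pair : ℕ → Form k
  pair m = var (2 * m) ⊕ var (suc (2 * m))

  pairDiff : ℕ → ℕ → Form k
  pairDiff a b = pair a ⊖ pair b

  var-≡ : ∀ {n} {v : Fin k} → toℕ v ≡ n → var n v ≡ 1ℚ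
  var-≡ {n = n} {v} v≡n with toℕ v ℕ.≟ n
  ... | yes _   = refl
  ... | no v≢n = contradiction v≡n v≢n

  var-≢ : ∀ {n} {v : Fin k} → toℕ v ≢ n → var n v ≡ 0ℚ
  var-≢ {n = n} {v} v≢n with toℕ v ℕ.≟ n
  ... | yes v≡n = contradiction v≡n v≢n
  ... | no _    = refl

  pair-inside : ∀ {m} {v : Fin k} → pairOf v ≡ m → pair m v ≡ 1ℚ
  pair-inside {m = m} {v} refl with n≡2⌊n/2⌋⊎n≡1+2⌊n/2⌋ (toℕ v)
  ... | inj₁ v≡even = cong₂ _+_ (var-≡ v≡even) (var-≢ λ v≡odd → ℕP.even≢odd m m (trans (sym v≡even) v≡odd))
  ... | inj₂ v≡odd  = cong₂ _+_ (var-≢ λ v≡even → ℕP.even≢odd m m (trans (sym v≡even) v≡odd)) (var-≡ v≡odd)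

  pair-outside : ∀ {m} {v : Fin k} → pairOf v ≢ m → pair m v ≡ 0ℚ
  pair-outside {m = m} v∉m = cong₂ _+_
    (var-≢ λ v≡even → v∉m (trans (cong ⌊_/2⌋ v≡even) (⌊2*n/2⌋≡n m)))
    (var-≢ λ v≡odd  → v∉m (trans (cong ⌊_/2⌋ v≡odd) (⌊1+2*n/2⌋≡n m)))

  diffForm-support : ∀ {i₁ i₂ i₃ i₄ w : Fin k} → diffForm i₁ i₂ i₃ i₄ w ≢ 0ℚ →
                     w ∈ i₁ ∷ i₂ ∷ i₃ ∷ i₄ ∷ []
  diffForm-support {k} {i₁} {i₂} {i₃} {i₄} {w} Dw≢0 =
    locate (toℕ w ℕ.≟ toℕ i₁) (toℕ w ℕ.≟ toℕ i₂) (toℕ w ℕ.≟ toℕ i₃) (toℕ w ℕ.≟ toℕ i₄)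
    where
    locate : Dec (toℕ w ≡ toℕ i₁) → Dec (toℕ w ≡ toℕ i₂) → Dec (toℕ w ≡ toℕ i₃) →
             Dec (toℕ w ≡ toℕ i₄) → w ∈ i₁ ∷ i₂ ∷ i₃ ∷ i₄ ∷ []
    locate (yes w≡i₁) _          _          _          = here (toℕ-injective w≡i₁)
    locate (no _)     (yes w≡i₂) _          _          = there (here (toℕ-injective w≡i₂))
    locate (no _)     (no _)     (yes w≡i₃) _          = there (there (here (toℕ-injective w≡i₃)))
    locate (no _)     (no _)     (no _)     (yes w≡i₄) = there (there (there (here (toℕ-injective w≡i₄))))
    locate (no w≢i₁)  (no w≢i₂)  (no w≢i₃)  (no w≢i₄)  =
      contradiction (cong₂ _+_ (cong₂ _-_ (cong₂ _-_ (var-≢ w≢i₁) (var-≢ w≢i₂)) (var-≢ w≢i₃)) (var-≢ w≢i₄))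
                    Dw≢0

  PairSymmetric : Form k → Set
  PairSymmetric g = ∀ {u v} → pairOf u ≡ pairOf v → g u ≡ g v

  pair-symmetric : ∀ m → PairSymmetric {k} (pair m)
  pair-symmetric m {u} {v} u~v with pairOf u ℕ.≟ m
  ... | yes u∈m = trans (pair-inside u∈m) (sym (pair-inside (trans (sym u~v) u∈m)))
  ... | no u∉m  = trans (pair-outside u∉m) (sym (pair-outside (u∉m ∘ trans u~v)))

  ⊖-symmetric : {f g : Form k} → PairSymmetric f → PairSymmetric g → PairSymmetric (f ⊖ g)
  ⊖-symmetric f-sym g-sym u~v = cong₂ _-_ (f-sym u~v) (g-sym u~v)

  ·-symmetric : {g : Form k} (r : ℚ) → PairSymmetric g → PairSymmetric (r · g)
  ·-symmetric r g-sym u~v = cong (_*ℚ_ r) (g-sym u~v)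

  pairDiff-symmetric : ∀ a b → PairSymmetric {k} (pairDiff a b)
  pairDiff-symmetric a b = ⊖-symmetric (pair-symmetric a) (pair-symmetric b)

  -- The star

  module _ {k : ℕ} (p : ℕ) where
    open LinearCombination (star {k} p)

    star-step : ∀ {i} → suc i < p → Implies (star p) (pairDiff i (suc i))
    star-step {i} i+1<p =
      implies-resp-≈ equation≈pairDiff (implies-∈ (∈-map⁺ _ (∈-upTo⁺ (ℕP.∸-monoˡ-≤ 1 i+1<p))))
      where
      equation≈pairDiff : (var (2 * i) ⊕ var (suc (2 * i)) ⊖ var (2 ℕ.+ 2 * i) ⊖ var (3 ℕ.+ 2 * i))
                          ≈ pairDiff i (suc i)
      equation≈pairDiff v rewrite ℕP.*-suc 2 i =
        solve 4 (λ x y z w → x :+ y :- z :- w := x :+ y :- (z :+ w)) refl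
          (var (2 * i) v) (var (suc (2 * i)) v) (var (2 ℕ.+ 2 * i) v) (var (3 ℕ.+ 2 * i) v)

    pairDiff₀-implied : ∀ {b} → b < p → Implies (star p) (pairDiff 0 b)
    pairDiff₀-implied {zero}  _   = implies-resp-≈ (λ v → sym (ℚP.+-inverseʳ (pair 0 v))) implies-𝟎
    pairDiff₀-implied {suc b} b<p =
      implies-resp-≈ telescope (implies-⊕ (pairDiff₀-implied (ℕP.<-trans (ℕP.n<1+n b) b<p)) (star-step b<p))
      where
      telescope : (pairDiff 0 b ⊕ pairDiff b (suc b)) ≈ pairDiff 0 (suc b)
      telescope v = solve 3 (λ x y z → x :- y :+ (y :- z) := x :- z) refl (pair 0 v) (pair b v) (pair (suc b) v)

    pairDiff-implied : ∀ {a b} → a < p → b < p → Implies (star p) (pairDiff a b)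
    pairDiff-implied {a} {b} a<p b<p =
      implies-resp-≈ difference (implies-⊖ (pairDiff₀-implied b<p) (pairDiff₀-implied a<p))
      where
      difference : (pairDiff 0 b ⊖ pairDiff 0 a) ≈ pairDiff a b
      difference v = solve 3 (λ x y z → z :- y :- (z :- x) := x :- y) refl (pair a v) (pair b v) (pair 0 v)

  module _ {A : Set} where

    Unique-lookup-injective : {xs : List A} → Unique xs → ∀ i j → lookup xs i ≡ lookup xs j → i ≡ j
    Unique-lookup-injective (_ ∷ _)     zero    zero    _     = refl
    Unique-lookup-injective (x∉xs ∷ _)  zero    (suc j) x≡xⱼ  = contradiction x≡xⱼ (All.lookup x∉xs (∈-lookup j))
    Unique-lookup-injective (xᵢ∉xs ∷ _) (suc i) zero    xᵢ≡x  = contradiction (sym xᵢ≡x) (All.lookup xᵢ∉xs (∈-lookup i))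
    Unique-lookup-injective (_ ∷ xs!)   (suc i) (suc j) xᵢ≡xⱼ = cong suc (Unique-lookup-injective xs! i j xᵢ≡xⱼ)

    Unique⇒length-mono-⊆ : {xs ys : List A} → Unique xs → xs ⊆ ys → length xs ≤ length ys
    Unique⇒length-mono-⊆ {xs} {ys} xs! xs⊆ys = ℕP.≮⇒≥ λ ys<xs →
      let i , j , i<j , same-position = pigeonhole ys<xs position
      in FinP.<⇒≢ i<j (Unique-lookup-injective xs! i j (begin
        lookup xs i                ≡⟨ lookup-index (xs⊆ys (∈-lookup i)) ⟩
        lookup ys (position i)     ≡⟨ cong (lookup ys) same-position ⟩
        lookup ys (position j)     ≡⟨ lookup-index (xs⊆ys (∈-lookup j)) ⟨
        lookup xs j                ∎))
      where
      open ≡-Reasoning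
      position : Fin (length xs) → Fin (length ys)
      position i = Any.index (xs⊆ys (∈-lookup i))

  pairsOf : List ℕ → List ℕ
  pairsOf []       = []
  pairsOf (m ∷ ms) = 2 * m ∷ suc (2 * m) ∷ pairsOf ms

  length-pairsOf : ∀ ms → length (pairsOf ms) ≡ 2 * length ms
  length-pairsOf []       = refl
  length-pairsOf (m ∷ ms) = trans (cong (λ n → suc (suc n)) (length-pairsOf ms)) (sym (ℕP.*-suc 2 (length ms)))

  ∈-pairsOf : ∀ {n ms} → ⌊ n /2⌋ ∈ ms → n ∈ pairsOf ms
  ∈-pairsOf {n} (here refl) with n≡2⌊n/2⌋⊎n≡1+2⌊n/2⌋ n
  ... | inj₁ n≡even = here n≡even
  ... | inj₂ n≡odd  = there (here n≡odd)
  ∈-pairsOf (there n∈ms) = there (there (∈-pairsOf n∈ms))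

  numVars≤2*pairs : (F : Fin t → Form k) (S : List ℕ) → (∀ i v → F i v ≢ 0ℚ → pairOf v ∈ S) →
                    numVars F ≤ 2 * length S
  numVars≤2*pairs {t = t} {k = k} F S F⊆S = begin
    numVars F             ≡⟨ length-map toℕ used ⟨
    length (map toℕ used) ≤⟨ Unique⇒length-mono-⊆ used! used⊆pairs ⟩
    length (pairsOf S)    ≡⟨ length-pairsOf S ⟩
    2 * length S          ∎
    where
    open ℕP.≤-Reasoning
    used? : ∀ j → Dec (Σ (Fin t) λ i → F i j ≢ 0ℚ)
    used? j = any? (λ i → ¬? (F i j ℚP.≟ 0ℚ))
    used : List (Fin k)
    used = filter used? (allFin k)
    used! : Unique (map toℕ used)
    used! = Unique.map⁺ toℕ-injective (Unique.filter⁺ used? {allFin k} (Unique.allFin⁺ k))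
    used⊆pairs : map toℕ used ⊆ pairsOf S
    used⊆pairs n∈ with v , v∈used , refl ← ∈-map⁻ toℕ n∈ =
      let i , Fᵢv≢0 = proj₂ (∈-filter⁻ used? {xs = allFin k} v∈used) in ∈-pairsOf (F⊆S i v Fᵢv≢0)

  -- Lightness

  c₀ : ℚ
  c₀ = + 63 / 32

  c₀≤c : ∀ {ε m c} → 0ℚ <ℚ ε → ε ≤ℚ + 1 / 4096 → + 2 / 1 - (ε *ℚ ε *ℚ (+ 1 / 32) ⊓ m) ≤ℚ c →
         c₀ ≤ℚ c
  c₀≤c {ε} {m} {c} ε>0 ε≤ c-bound = begin
    + 2 / 1 - 1ℚ *ℚ (+ 1 / 32)           ≤⟨ ℚP.+-monoʳ-≤ (+ 2 / 1) (ℚP.neg-antimono-≤ ε²/32⊓m≤1/32) ⟩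
    + 2 / 1 - (ε *ℚ ε *ℚ (+ 1 / 32) ⊓ m) ≤⟨ c-bound ⟩
    c                                    ∎
    where
    open ℚP.≤-Reasoning
    instance
      ε-nonNeg : ℚ.NonNegative ε
      ε-nonNeg = ℚP.pos⇒nonNeg ε {{ℚ.positive ε>0}}
    ε≤1 : ε ≤ℚ 1ℚ
    ε≤1 = ℚP.≤-trans ε≤ (toWitness {a? = + 1 / 4096 ℚP.≤? 1ℚ} _)
    ε²≤1 : ε *ℚ ε ≤ℚ 1ℚ
    ε²≤1 = ℚP.≤-trans (ℚP.*-monoʳ-≤-nonNeg ε ε≤1) (subst (_≤ℚ 1ℚ) (sym (ℚP.*-identityˡ ε)) ε≤1)
    ε²/32⊓m≤1/32 : ε *ℚ ε *ℚ (+ 1 / 32) ⊓ m ≤ℚ 1ℚ *ℚ (+ 1 / 32)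
    ε²/32⊓m≤1/32 = ℚP.≤-trans (ℚP.p⊓q≤p _ m) (ℚP.*-monoʳ-≤-nonNeg (+ 1 / 32) ε²≤1)

  2t<c₀t+1 : ∀ {t} → t < 5 → ℕ→ℚ (2 * suc t) <ℚ c₀ *ℚ ℕ→ℚ (suc t) + 1ℚ
  2t<c₀t+1 = toWitness {a? = ℕP.allUpTo? (λ t → ℕ→ℚ (2 * suc t) ℚP.<? c₀ *ℚ ℕ→ℚ (suc t) + 1ℚ) 5} _

  nonzero-independent : {g : Form k} {u : Fin k} → g u ≢ 0ℚ → Independent {t = 1} (λ _ → g)
  nonzero-independent {g = g} {u} gu≢0 a ∑≡0 zero =
    p*q≡0⇒p≡0 gu≢0 (trans (sym (ℚP.+-identityʳ (a zero *ℚ g u))) (∑≡0 u))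

  module Lightness {k : ℕ} (W : List (Form k)) {c} (c₀≤c : c₀ ≤ℚ c) (light : Light c W) where

    independent-on-few-pairs⇒⊥ : ∀ {t} (F : Fin (suc t) → Form k) → Independent F → (∀ i → Implies W (F i)) →
                                 t < 5 → (S : List ℕ) → length S ≤ suc t →
                                 (∀ i v → F i v ≢ 0ℚ → pairOf v ∈ S) → ⊥
    independent-on-few-pairs⇒⊥ {t} F F-independent ⊢F t<5 S |S|≤t F⊆S = ℚP.<-irrefl refl (begin-strict
      c *ℚ ℕ→ℚ (suc t) + 1ℚ  ≤⟨ light (suc t) (s≤s z≤n) F F-independent ⊢F ⟩
      ℕ→ℚ (numVars F)         ≤⟨ ℕ→ℚ-mono-≤ (ℕP.≤-trans (numVars≤2*pairs F S F⊆S) (ℕP.*-monoʳ-≤ 2 |S|≤t)) ⟩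
      ℕ→ℚ (2 * suc t)         <⟨ 2t<c₀t+1 t<5 ⟩
      c₀ *ℚ ℕ→ℚ (suc t) + 1ℚ ≤⟨ ℚP.+-monoˡ-≤ 1ℚ (ℚP.*-monoʳ-≤-nonNeg (ℕ→ℚ (suc t)) c₀≤c) ⟩
      c *ℚ ℕ→ℚ (suc t) + 1ℚ  ∎)
      where
      open ℚP.≤-Reasoning
      instance
        t-nonNeg : ℚ.NonNegative (ℕ→ℚ (suc t))
        t-nonNeg = ℚP.normalize-nonNeg (suc t) 1

    implied-multiple-of-pair⇒0 : ∀ {r m} (u : Fin k) → pairOf u ≡ m → Implies W (r · pair m) → r ≡ 0ℚ
    implied-multiple-of-pair⇒0 {r} {m} u u∈m ⊢rPₘ = decidable-stable (r ℚP.≟ 0ℚ) λ r≢0 →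
      independent-on-few-pairs⇒⊥ (λ _ → r · pair m) (nonzero-independent {g = r · pair m} {u} (rPₘu≢0 r≢0))
                                 (λ _ → ⊢rPₘ) (s≤s z≤n) (m ∷ []) ℕP.≤-refl rPₘ⊆m
      where
      rPₘu≢0 : r ≢ 0ℚ → r *ℚ pair m u ≢ 0ℚ
      rPₘu≢0 = subst (_≢ 0ℚ) (trans (sym (ℚP.*-identityʳ r)) (cong (_*ℚ_ r) (sym (pair-inside u∈m))))
      rPₘ⊆m : ∀ i v → r *ℚ pair m v ≢ 0ℚ → pairOf v ∈ m ∷ []
      rPₘ⊆m _ v rPₘv≢0 with pairOf v ℕ.≟ m
      ... | yes v∈m = here v∈m
      ... | no  v∉m = contradiction (trans (cong (_*ℚ_ r) (pair-outside v∉m)) (ℚP.*-zeroʳ r)) rPₘv≢0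

  OnPairsBelow : ℕ → Form k → Set
  OnPairsBelow q g = ∀ v → q ≤ pairOf v → g v ≡ 0ℚ

  InVars⇒OnPairsBelow : ∀ {q} {g : Form k} → InVars (2 * q) g → OnPairsBelow q g
  InVars⇒OnPairsBelow g<2q v q≤v = g<2q v (ℕP.≤-trans (ℕP.*-monoʳ-≤ 2 q≤v) (2*⌊n/2⌋≤n (toℕ v)))

  OnPairsBelow⇒support< : ∀ {q} {g : Form k} → OnPairsBelow q g → ∀ v → g v ≢ 0ℚ → pairOf v < q
  OnPairsBelow⇒support< g<q v gv≢0 = ℕP.≰⇒> (gv≢0 ∘ g<q v)

  pairDiff-support : ∀ {a b} {v : Fin k} → pairDiff a b v ≢ 0ℚ → pairOf v ≡ a ⊎ pairOf v ≡ b
  pairDiff-support {a = a} {b} {v} Dv≢0 with pairOf v ℕ.≟ a | pairOf v ℕ.≟ b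
  ... | yes v∈a | _       = inj₁ v∈a
  ... | no  _   | yes v∈b = inj₂ v∈b
  ... | no  v∉a | no  v∉b = contradiction (cong₂ _-_ (pair-outside v∉a) (pair-outside v∉b)) Dv≢0

  module _ {k : ℕ} (p : ℕ) (2p≤k : 2 * p ≤ k) where

    representative : ∀ {m} → m < p → Σ (Fin k) λ v → pairOf v ≡ m
    representative {m} m<p = fromℕ< 2m<k , trans (cong ⌊_/2⌋ (toℕ-fromℕ< 2m<k)) (⌊2*n/2⌋≡n m)
      where
      2m<k : 2 * m < k
      2m<k = ℕP.<-≤-trans (ℕP.*-monoʳ-< 2 m<p) 2p≤k

    -- Comparing the two variables of pair m cancels every P_m − P_j and isolates the coefficient of g;
    -- a variable of pair j then isolates the coefficient of P_m − P_j.
    asymmetric-family-independent : ∀ {g : Form k} {m u v} {J : List ℕ} →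
                                    pairOf u ≡ m → pairOf v ≡ m → g u ≢ g v → Unique (m ∷ J) → All (_< p) J →
                                    Independent (g ◂ λ i → pairDiff m (lookup J i))
    asymmetric-family-independent {g} {m} {u} {v} {J} u∈m v∈m gu≢gv (m∉J ∷ J!) J<p a ∑≡0 = a≡0
      where
      rest : Form k
      rest w = sumᶠ (λ i → a (suc i) *ℚ pairDiff m (lookup J i) w)
      rest-symmetric : rest u ≡ rest v
      rest-symmetric =
        sumᶠ-cong λ i → cong (_*ℚ_ (a (suc i))) (pairDiff-symmetric m (lookup J i) (trans u∈m (sym v∈m)))
      a₀≡0 : a zero ≡ 0ℚ
      a₀≡0 = p*q≡0⇒p≡0 (gu≢gv ∘ x∙y⁻¹≈ε⇒x≈y (g u) (g v)) (begin
        a zero *ℚ (g u - g v)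
          ≡⟨ solve 5 (λ a x y s t → a :* (x :- y) := (a :* x :+ s) :- (a :* y :+ t) :- (s :- t)) refl
                     (a zero) (g u) (g v) (rest u) (rest v) ⟩
        (a zero *ℚ g u + rest u) - (a zero *ℚ g v + rest v) - (rest u - rest v)
          ≡⟨ cong₂ _-_ (cong₂ _-_ (∑≡0 u) (∑≡0 v)) (cong (_- rest v) rest-symmetric) ⟩
        0ℚ - 0ℚ - (rest v - rest v)
          ≡⟨ cong (_-_ 0ℚ) (ℚP.+-inverseʳ (rest v)) ⟩
        0ℚ ∎)
        where open ≡-Reasoning
      aᵢ₊₁≡0 : ∀ i → a (suc i) ≡ 0ℚ
      aᵢ₊₁≡0 i = p*q≡0⇒p≡0 (λ ()) (begin
        a (suc i) *ℚ (0ℚ - 1ℚ)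
          ≡⟨ cong (_*ℚ_ (a (suc i))) (cong₂ _-_ (pair-outside w∉m) (pair-inside w∈Jᵢ)) ⟨
        a (suc i) *ℚ pairDiff m (lookup J i) w
          ≡⟨ sumᶠ-single (λ j → a (suc j) *ℚ pairDiff m (lookup J j) w) i others≡0 ⟨
        rest w
          ≡⟨ ℚP.+-identityˡ (rest w) ⟨
        0ℚ + rest w
          ≡⟨ cong (λ x → x + rest w) (trans (cong (_*ℚ g w) a₀≡0) (ℚP.*-zeroˡ (g w))) ⟨
        a zero *ℚ g w + rest w
          ≡⟨ ∑≡0 w ⟩
        0ℚ ∎)
        where
        open ≡-Reasoning
        w : Fin k
        w = proj₁ (representative (All.lookup J<p (∈-lookup i)))
        w∈Jᵢ : pairOf w ≡ lookup J i
        w∈Jᵢ = proj₂ (representative (All.lookup J<p (∈-lookup i)))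
        w∉m : pairOf w ≢ m
        w∉m w∈m = All.lookup m∉J (∈-lookup i) (trans (sym w∈m) w∈Jᵢ)
        others≡0 : ∀ j → j ≢ i → a (suc j) *ℚ pairDiff m (lookup J j) w ≡ 0ℚ
        others≡0 j j≢i = trans (cong (_*ℚ_ (a (suc j))) (cong₂ _-_
          (pair-outside w∉m)
          (pair-outside (j≢i ∘ sym ∘ Unique-lookup-injective J! i j ∘ trans (sym w∈Jᵢ)))))
          (ℚP.*-zeroʳ (a (suc j)))
      a≡0 : ∀ i → a i ≡ 0ℚ
      a≡0 zero    = a₀≡0
      a≡0 (suc i) = aᵢ₊₁≡0 i

    open LinearCombination (star {k} p)

    symmetric⇒implied-modulo-pair₀ : ∀ q → q ≤ p → (g : Form k) → PairSymmetric g → OnPairsBelow q g →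
                                     ∃[ r ] Implies (star p) (g ⊖ r · pair 0)
    symmetric⇒implied-modulo-pair₀ zero _ g _ g<0 = 0ℚ , implies-resp-≈ 𝟎≈g implies-𝟎
      where
      𝟎≈g : 𝟎 ≈ (g ⊖ 0ℚ · pair 0)
      𝟎≈g v = sym (cong₂ _-_ (g<0 v z≤n) (ℚP.*-zeroˡ (pair 0 v)))
    symmetric⇒implied-modulo-pair₀ (suc m) m<p g g-symmetric g<m+1 =
      r + s , implies-resp-≈ regroup (implies-⊕ ⊢rest (implies-· s (pairDiff-implied p m<p (ℕP.≤-<-trans z≤n m<p))))
      where
      w : Fin k
      w = proj₁ (representative m<p)
      w∈m : pairOf w ≡ m
      w∈m = proj₂ (representative m<p)
      s : ℚ
      s = g w
      peeled : Form k
      peeled = g ⊖ s · pair m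
      peeled<m : OnPairsBelow m peeled
      peeled<m v m≤v with ℕP.m≤n⇒m<n∨m≡n m≤v
      ... | inj₁ m<v = trans (cong₂ _-_ (g<m+1 v m<v) (cong (_*ℚ_ s) (pair-outside (ℕP.<⇒≢ m<v ∘ sym))))
                             (cong (_-_ 0ℚ) (ℚP.*-zeroʳ s))
      ... | inj₂ m≡v = begin
        g v - s *ℚ pair m v ≡⟨ cong₂ (λ x y → x - s *ℚ y) (g-symmetric (trans (sym m≡v) (sym w∈m)))
                                                         (pair-inside (sym m≡v)) ⟩
        s - s *ℚ 1ℚ         ≡⟨ cong (_-_ s) (ℚP.*-identityʳ s) ⟩
        s - s               ≡⟨ ℚP.+-inverseʳ s ⟩
        0ℚ                  ∎
        where open ≡-Reasoning
      peeled-implied : ∃[ r ] Implies (star p) (peeled ⊖ r · pair 0)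
      peeled-implied = symmetric⇒implied-modulo-pair₀ m (ℕP.<⇒≤ m<p) peeled
                         (⊖-symmetric g-symmetric (·-symmetric s (pair-symmetric m))) peeled<m
      r : ℚ
      r = proj₁ peeled-implied
      ⊢rest : Implies (star p) (peeled ⊖ r · pair 0)
      ⊢rest = proj₂ peeled-implied
      regroup : ((peeled ⊖ r · pair 0) ⊕ s · pairDiff m 0) ≈ (g ⊖ (r + s) · pair 0)
      regroup v = solve 5 (λ x s r y z → x :- s :* y :- r :* z :+ s :* (y :- z) := x :- (r :+ s) :* z) refl
                    (g v) s r (pair m v) (pair 0 v)

  module LightConfiguration {k : ℕ} (W : List (Form k)) {c} (c₀≤c : c₀ ≤ℚ c) (light : Light c W)
                  (p : ℕ) (2p≤k : 2 * p ≤ k) (W⊢star : All (Implies W) (star p)) where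
    open Lightness W c₀≤c light
    open LinearCombination W

    asymmetric-pair⇒⊥ : ∀ {g : Form k} {m u v} → Implies W g → pairOf u ≡ m → pairOf v ≡ m → g u ≢ g v →
                        (J : List ℕ) → Unique (m ∷ J) → All (_< p) (m ∷ J) → length J < 5 →
                        (∀ w → g w ≢ 0ℚ → pairOf w ∈ m ∷ J) → ⊥
    asymmetric-pair⇒⊥ {g} {m} ⊢g u∈m v∈m gu≢gv J mJ! (m<p ∷ J<p) |J|<5 g⊆mJ =
      independent-on-few-pairs⇒⊥ F (asymmetric-family-independent p 2p≤k u∈m v∈m gu≢gv mJ! J<p) ⊢F |J|<5
                                 (m ∷ J) ℕP.≤-refl F⊆mJ
      where
      F : Fin (suc (length J)) → Form k
      F = g ◂ λ i → pairDiff m (lookup J i)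
      ⊢F : ∀ i → Implies W (F i)
      ⊢F zero    = ⊢g
      ⊢F (suc i) = implies-trans {L = W} W⊢star (pairDiff-implied p m<p (All.lookup J<p (∈-lookup i)))
      F⊆mJ : ∀ i w → F i w ≢ 0ℚ → pairOf w ∈ m ∷ J
      F⊆mJ zero    w gw≢0 = g⊆mJ w gw≢0
      F⊆mJ (suc i) w Dw≢0 with pairDiff-support Dw≢0
      ... | inj₁ w∈m  = here w∈m
      ... | inj₂ w∈Jᵢ = there (subst (_∈ J) (sym w∈Jᵢ) (∈-lookup i))

    few-pairs⇒symmetric : ∀ {g : Form k} → Implies W g → (hs : List ℕ) → length hs ≤ 4 → All (_< p) hs →
                          (∀ w → g w ≢ 0ℚ → pairOf w ∈ hs) → PairSymmetric g
    few-pairs⇒symmetric {g} ⊢g hs |hs|≤4 hs<p g⊆hs {u} {v} u~v = decidable-stable (g u ℚP.≟ g v) λ gu≢gv →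
      asymmetric-pair⇒⊥ ⊢g refl (sym u~v) gu≢gv J (deduplicate-! (m ∷ hs)) (mJ<p gu≢gv) |J|<5 g⊆mJ
      where
      m : ℕ
      m = pairOf u
      J : List ℕ
      J = filter (λ x → ¬? (m ℕ.≟ x)) (deduplicate ℕ._≟_ hs)
      m∈hs : g u ≢ g v → m ∈ hs
      m∈hs gu≢gv = [ g⊆hs u , subst (_∈ hs) (sym u~v) ∘ g⊆hs v ] (p≢q⇒p≢0⊎q≢0 gu≢gv)
      mJ<p : g u ≢ g v → All (_< p) (m ∷ J)
      mJ<p gu≢gv = All.tabulate λ x∈mJ →
        All.lookup (All.lookup hs<p (m∈hs gu≢gv) ∷ hs<p) (∈-deduplicate⁻ ℕ._≟_ (m ∷ hs) x∈mJ)
      |J|<5 : length J < 5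
      |J|<5 = s≤s (ℕP.≤-trans (length-filter (λ x → ¬? (m ℕ.≟ x)) (deduplicate ℕ._≟_ hs))
                    (ℕP.≤-trans (length-deduplicate ℕ._≟_ hs) |hs|≤4))
      g⊆mJ : ∀ w → g w ≢ 0ℚ → pairOf w ∈ m ∷ J
      g⊆mJ w gw≢0 = ∈-deduplicate⁺ ℕ._≟_ (there (g⊆hs w gw≢0))

    symmetric⇒implied-by-star : ∀ {g : Form k} → 0 < k → Implies W g → PairSymmetric g → OnPairsBelow p g →
                                Implies (star p) g
    symmetric⇒implied-by-star {g} 0<k ⊢g g-symmetric g<p =
      LinearCombination.implies-resp-≈ (star p) g-rP₀≈g ⊢g-rP₀
      where
      modulo-pair₀ : ∃[ r ] Implies (star p) (g ⊖ r · pair 0)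
      modulo-pair₀ = symmetric⇒implied-modulo-pair₀ p 2p≤k p ℕP.≤-refl g g-symmetric g<p
      r : ℚ
      r = proj₁ modulo-pair₀
      ⊢g-rP₀ : Implies (star p) (g ⊖ r · pair 0)
      ⊢g-rP₀ = proj₂ modulo-pair₀
      ⊢rP₀ : Implies W (r · pair 0)
      ⊢rP₀ = implies-resp-≈ (λ v → solve 2 (λ x y → x :- (x :- y) := y) refl (g v) (r *ℚ pair 0 v))
                            (implies-⊖ ⊢g (implies-trans {L = W} W⊢star ⊢g-rP₀))
      r≡0 : r ≡ 0ℚ
      r≡0 = implied-multiple-of-pair⇒0 (fromℕ< 0<k) (cong ⌊_/2⌋ (toℕ-fromℕ< 0<k)) ⊢rP₀
      g-rP₀≈g : (g ⊖ r · pair 0) ≈ g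
      g-rP₀≈g v = begin
        g v - r *ℚ pair 0 v   ≡⟨ cong (λ x → g v - x *ℚ pair 0 v) r≡0 ⟩
        g v - 0ℚ *ℚ pair 0 v  ≡⟨ cong (_-_ (g v)) (ℚP.*-zeroˡ (pair 0 v)) ⟩
        g v - 0ℚ              ≡⟨ ℚP.+-identityʳ (g v) ⟩
        g v                   ∎
        where open ≡-Reasoning

    implied-diffEq-symmetric : ∀ {f : Form k} → Implies W f → IsDiffEq f → OnPairsBelow p f → PairSymmetric f
    implied-diffEq-symmetric {f} ⊢f (i₁ , i₂ , i₃ , i₄ , f≈D , _) f<p =
      few-pairs⇒symmetric ⊢f (filter (_<? p) met) (length-filter (_<? p) met) (all-filter (_<? p) met) f⊆pairs
      where
      met : List ℕ
      met = map pairOf (i₁ ∷ i₂ ∷ i₃ ∷ i₄ ∷ [])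
      f⊆pairs : ∀ w → f w ≢ 0ℚ → pairOf w ∈ filter (_<? p) met
      f⊆pairs w fw≢0 = ∈-filter⁺ (_<? p) (∈-map⁺ pairOf (diffForm-support (fw≢0 ∘ trans (f≈D w))))
                                 (OnPairsBelow⇒support< f<p w fw≢0)

open import Defs
open import Data.Nat using (ℕ; _≤_; _*_)
open import Data.Integer using (+_)
open import Data.List.Relation.Unary.All using (All)
open import Data.Rational using (ℚ; 0ℚ; _<_; _-_; _/_; _⊓_; 1/_; >-nonZero) renaming (_≤_ to _≤ℚ_; _*_ to _*ℚ_)

open import Data.Product using (_,_)
open PairSymmetry using (c₀≤c; OnPairsBelow; InVars⇒OnPairsBelow; module LightConfiguration)

lemma4p7 : (ε k₀ c : ℚ) (ε>0 : 0ℚ < ε) → ε ≤ℚ (+ 1 / 4096) →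
  (k₀>0 : 0ℚ < k₀) →
  (+ 32 / 1) *ℚ (1/_ ε {{>-nonZero ε>0}}) *ℚ (1/_ ε {{>-nonZero ε>0}}) ≤ℚ k₀ →
  (+ 2 / 1) - ((ε *ℚ ε *ℚ (+ 1 / 32)) ⊓ ((+ 2 / 1) *ℚ (1/_ k₀ {{>-nonZero k₀>0}}))) ≤ℚ c →
  c ≤ℚ (+ 2 / 1) →
  (k : ℕ) → 1 ≤ k → (C : Config k) → Good c (eqs C) →
  (p : ℕ) → 2 * p ≤ k →
  All (Implies (eqs C)) (star p) →
  (f : Form k) → IsDiffEq f → InVars (2 * p) f → Implies (eqs C) f →
  Implies (star p) f
lemma4p7 ε k₀ c ε>0 ε≤1/4096 _ _ c-bound _ k 0<k C (_ , _ , light) p 2p≤k W⊢star f f-diffEq f<2p ⊢f =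
  symmetric⇒implied-by-star 0<k ⊢f (implied-diffEq-symmetric ⊢f f-diffEq f<p) f<p
  where
  open LightConfiguration (eqs C) (c₀≤c ε>0 ε≤1/4096 c-bound) light p 2p≤k W⊢star
  f<p : OnPairsBelow p f
  f<p = InVars⇒OnPairsBelow f<2p
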